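{- For every PLTL formula $W$, the number of PLTL-clauses generated by the translation $\tau_0[W]$ into SNF (i.e. the number of conjuncts $\Box A_i$ in $\tau_0[W]$) is at most $1+11\cdot\mathrm{len}(W)$.
   Context: PLTL formulae are built from proposition symbols, $\mathbf{true}$, $\mathbf{false}$, $\neg,\vee,\wedge,\Rightarrow$ and temporal operators $\bigcirc$ (next), $\Diamond$ (sometime), $\Box$ (always), $\mathcal{U}$ (until), $\mathcal{W}$ (unless); $\mathbf{start}$ is a nullary connective true only at the first moment. A literal is a proposition symbol or its negation. A PLTL-clause is a formula $\mathbf{start}\Rightarrow\bigvee_c l_c$, $\bigwedge_a k_a\Rightarrow\bigcirc\bigvee_d l_d$ or $\bigwedge_b k_b\Rightarrow\Diamond l$ with all $k,l$ literals. The translation: $\tau_0[A]=\Box(\mathbf{start}\Rightarrow y)\wedge\tau_1[\Box(y\Rightarrow A)]$ with $y$ a fresh proposition symbol, where $\tau_1$, applied to $\Box(x\Rightarrow W)$ ($x$ a proposition symbol), is computed by applying the following rewrite rules repeatedly until the result is a conjunction of formulae $\Box A_i$, each $A_i$ a PLTL-clause (write $\tau_1[x\Rightarrow A]$ for $\tau_1[\Box(x\Rightarrow A)]$; $y,z,v$ are proposition symbols new at each application; $l,m,l_i$ literals; $\neg\mathbf{true}$, $\neg\mathbf{false}$ rewritten to $\mathbf{false}$, $\mathbf{true}$). (1) $x\Rightarrow(A\wedge B)\mapsto\tau_1[x\Rightarrow A]\wedge\tau_1[x\Rightarrow B]$; $x\Rightarrow(A\Rightarrow B)\mapsto\tau_1[x\Rightarrow\neg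 A\vee B]$; $x\Rightarrow\neg(A\wedge B)\mapsto\tau_1[x\Rightarrow\neg A\vee\neg B]$; $x\Rightarrow\neg(A\Rightarrow B)\mapsto\tau_1[x\Rightarrow A]\wedge\tau_1[x\Rightarrow\neg B]$; $x\Rightarrow\neg(A\vee B)\mapsto\tau_1[x\Rightarrow\neg A]\wedge\tau_1[x\Rightarrow\neg B]$. (2) $x\Rightarrow\bigcirc A\mapsto\Box(x\Rightarrow\bigcirc y)\wedge\tau_1[y\Rightarrow A]$ if $A$ is neither a literal nor a disjunction of literals; $x\Rightarrow\neg\bigcirc A\mapsto\Box(x\Rightarrow\bigcirc y)\wedge\tau_1[y\Rightarrow\neg A]$; $x\Rightarrow\Box A\mapsto\tau_1[x\Rightarrow\Box y]\wedge\tau_1[y\Rightarrow A]$ ($A$ not a literal); $x\Rightarrow\neg\Box A\mapsto\Box(x\Rightarrow\Diamond y)\wedge\tau_1[y\Rightarrow\neg A]$; $x\Rightarrow\Diamond A\mapsto\Box(x\Rightarrow\Diamond y)\wedge\tau_1[y\Rightarrow A]$ ($A$ not a literal); $x\Rightarrow\neg\Diamond A\mapsto\tau_1[x\Rightarrow\Box y]\wedge\tau_1[y\Rightarrow\neg A]$; $x\Rightarrow A\,\mathcal{U}\,B\mapsto\tau_1[x\Rightarrow y\,\mathcal{U}\,B]\wedge\tau_1[y\Rightarrow A]$ ($A$ not a literal), $\mapsto\tau_1[x\Rightarrow A\,\mathcal{U}\,y]\wedge\tau_1[y\Rightarrow B]$ ($B$ not a literal); the same with $\mathcal{W}$ for $\mathcal{U}$;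 $x\Rightarrow\neg(A\,\mathcal{U}\,B)\mapsto\tau_1[x\Rightarrow y\,\mathcal{W}\,v]\wedge\tau_1[y\Rightarrow\neg B]\wedge\tau_1[v\Rightarrow(y\wedge z)]\wedge\tau_1[z\Rightarrow\neg A]$; $x\Rightarrow\neg(A\,\mathcal{W}\,B)\mapsto\tau_1[x\Rightarrow y\,\mathcal{U}\,v]\wedge\tau_1[y\Rightarrow\neg B]\wedge\tau_1[v\Rightarrow(y\wedge z)]\wedge\tau_1[z\Rightarrow\neg A]$. (3) $x\Rightarrow\Box l\mapsto\tau_1[x\Rightarrow l]\wedge\tau_1[x\Rightarrow y]\wedge\Box(y\Rightarrow\bigcirc l)\wedge\Box(y\Rightarrow\bigcirc y)$; $x\Rightarrow l\,\mathcal{U}\,m\mapsto\Box(x\Rightarrow\Diamond m)\wedge\tau_1[x\Rightarrow l\vee m]\wedge\tau_1[x\Rightarrow y\vee m]\wedge\Box(y\Rightarrow\bigcirc(l\vee m))\wedge\Box(y\Rightarrow\bigcirc(y\vee m))$; $x\Rightarrow l\,\mathcal{W}\,m\mapsto$ the same without $\Box(x\Rightarrow\Diamond m)$. (4) $x\Rightarrow D\vee A\mapsto\tau_1[x\Rightarrow D\vee y]\wedge\tau_1[y\Rightarrow A]$, $D$ a disjunction, $A$ neither a literal nor a disjunction of literals. (5) $x\Rightarrow D\mapsto\Box(\mathbf{start}\Rightarrow\neg x\vee D)\wedge\Box(\mathbf{true}\Rightarrow\bigcirc(\neg x\vee D))$ for $D$ a literal or disjunction of literals; $x\Rightarrow\mathbf{true}\mapsto\Box(\mathbf{start}\Rightarrow\mathbf{true})\wedge\Box(\mathbf{true}\Rightarrow\bigcirc\mathbf{true})$;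 $x\Rightarrow\mathbf{false}\mapsto\Box(\mathbf{start}\Rightarrow\neg x)\wedge\Box(\mathbf{true}\Rightarrow\bigcirc\neg x)$; $\tau_1[x\Rightarrow\Diamond l]=\Box(x\Rightarrow\Diamond l)$; $\tau_1[x\Rightarrow\bigcirc(l_1\vee\dots\vee l_n)]=\Box(x\Rightarrow\bigcirc(l_1\vee\dots\vee l_n))$. Length: $\mathrm{len}(\Diamond l)=1$; $\mathrm{len}(l_1\vee\dots\vee l_n)=1$ ($n\ge1$); $\mathrm{len}(c)=1$ for $c\in\{\mathbf{true},\neg\mathbf{true},\mathbf{false},\neg\mathbf{false}\}$; $\mathrm{len}(\bigcirc(l_1\vee\dots\vee l_n))=1$; $\mathrm{len}(\neg\Box A)=\mathrm{len}(\neg\Diamond A)=\mathrm{len}(\neg\bigcirc A)=1+\mathrm{len}(\neg A)$; $\mathrm{len}(\Box A)=1+\mathrm{len}(A)$; $\mathrm{len}(\Diamond A)=1+\mathrm{len}(A)$ ($A$ not a literal); $\mathrm{len}(\bigcirc A)=1+\mathrm{len}(A)$ ($A$ not a disjunction of literals); for $\circ\in\{\mathcal{U},\mathcal{W},\vee,\wedge\}$: $\mathrm{len}(\neg(A\circ B))=1+\mathrm{len}(\neg A)+\mathrm{len}(\neg B)$ and $\mathrm{len}(A\circ B)=1+\mathrm{len}(A)+\mathrm{len}(B)$ (for $\vee$: $A,B$ not disjunctions of literals); $\mathrm{len}(\neg(A\Rightarrow B))=1+\mathrm{len}(A)+\mathrm{len}(\neg B)$; $\mathrm{len}(A\Rightarrow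 B)=1+\mathrm{len}(\neg A)+\mathrm{len}(B)$. -}

module Defs where

open import Data.Nat using (ℕ; zero; suc; _+_; _*_; _≤_)
open import Data.Bool using (Bool; true; false; not; if_then_else_)
open import Data.List using (List; []; _∷_; _++_; length)
open import Data.Maybe using (Maybe; just; nothing; is-just)
open import Data.Product using (_×_; _,_; proj₁; proj₂)

infixr 4 _∨_
infixr 5 _∧_
infixr 3 _⇒_
infixr 6 _U_ _W_
infix 7 ¬_ ○_ ◇_ □_

data Form : Set where
  var      : ℕ → Form
  ⊤f ⊥f    : Form
  ¬_       : Form → Form
  _∨_ _∧_ _⇒_ : Form → Form → Form
  ○_ ◇_ □_ : Form → Form
  _U_ _W_  : Form → Form → Form

data Atom : Set where
  orig  : ℕ → Atom
  fresh : ℕ → Atom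

-- a literal: polarity (true = positive) and an atom
Lit : Set
Lit = Bool × Atom

data Disj : Set where
  lits  : List Lit → Disj
  dtrue : Disj

data Clause : Set where
  initial  : Disj → Clause               -- start ⇒ D
  step     : List Lit → Disj → Clause    -- (∧ k) ⇒ ○ D   ([] = true)
  sometime : List Lit → Lit → Clause     -- (∧ k) ⇒ ◇ l

-- Recognisers.  A formula is read under a polarity (true = as is,
-- false = under one negation); ¬¬A is identified with A and ¬true, ¬false
-- with false, true.

litOf : Bool → Form → Maybe Lit
litOf p (var n) = just (p , orig n)
litOf p (¬ A)   = litOf (not p) A
litOf p _       = nothing

litsOf : Bool → Form → Maybe (List Lit)
litsOf p (var n) = just ((p , orig n) ∷ [])
litsOf p (¬ A)   = litsOf (not p) A
litsOf true (A ∨ B) with litsOf true A | litsOf true B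
... | just ls | just ms = just (ls ++ ms)
... | _       | _       = nothing
litsOf p _ = nothing

-- A fresh-name generator (state = next unused index for fresh symbols)

Gen : Set → Set
Gen A = ℕ → A × ℕ

return : {A : Set} → A → Gen A
return a n = a , n

_>>=_ : {A B : Set} → Gen A → (A → Gen B) → Gen B
(m >>= f) n = f (proj₁ (m n)) (proj₂ (m n))

_>>_ : {A B : Set} → Gen A → Gen B → Gen B
m >> k = m >>= λ _ → k

new : Gen Atom
new n = fresh n , suc n

-- rule (5): x ⇒ D   ↦   start ⇒ ¬x ∨ D ,  true ⇒ ○(¬x ∨ D)
impD : Atom → List Lit → List Clause
impD x D = initial (lits ((false , x) ∷ D)) ∷ step [] (lits ((false , x) ∷ D)) ∷ []

-- rule (3): x ⇒ □ l   (y fresh)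
boxLit : Atom → Lit → Gen (List Clause)
boxLit x l = do
  y ← new
  return (impD x (l ∷ []) ++ impD x ((true , y) ∷ [])
          ++ step ((true , y) ∷ []) (lits (l ∷ [])) ∷ step ((true , y) ∷ []) (lits ((true , y) ∷ [])) ∷ [])

-- rule (3): x ⇒ l W m   (y fresh)
unlessLit : Atom → Lit → Lit → Gen (List Clause)
unlessLit x l m = do
  y ← new
  return (impD x (l ∷ m ∷ []) ++ impD x ((true , y) ∷ m ∷ [])
          ++ step ((true , y) ∷ []) (lits (l ∷ m ∷ []))
          ∷ step ((true , y) ∷ []) (lits ((true , y) ∷ m ∷ [])) ∷ [])

-- rule (3): x ⇒ l U m
untilLit : Atom → Lit → Lit → Gen (List Clause)
untilLit x l m = do
  cs ← unlessLit x l m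
  return (sometime ((true , x) ∷ []) m ∷ cs)

-- The translation τ₁.  tr x p A computes τ₁[x ⇒ A] (p = true) or
-- τ₁[x ⇒ ¬A] (p = false) as the list of its clauses.
-- disj p A processes A (under polarity p) as (part of) a disjunction,
-- disjunctions being taken modulo associativity/commutativity (rule 4):
-- it returns the literals of the resulting clause x ⇒ D together with the
-- clauses τ₁[y ⇒ A'] for the non-literal disjuncts A' replaced by fresh y.
-- lit p A: if A is a literal return it, otherwise replace it by a fresh
-- y and also return τ₁[y ⇒ A].

mutual
  tr : Atom → Bool → Form → Gen (List Clause)
  -- literals (rule 5)
  tr x p (var n) = return (impD x ((p , orig n) ∷ []))
  -- true / false (rule 5)
  tr x true  ⊤f = return (initial dtrue ∷ step [] dtrue ∷ [])
  tr x false ⊥f = return (initial dtrue ∷ step [] dtrue ∷ [])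
  tr x true  ⊥f = return (initial (lits ((false , x) ∷ [])) ∷ step [] (lits ((false , x) ∷ [])) ∷ [])
  tr x false ⊤f = return (initial (lits ((false , x) ∷ [])) ∷ step [] (lits ((false , x) ∷ [])) ∷ [])
  tr x p (¬ A) = tr x (not p) A
  -- rule (1)
  tr x true  (A ∧ B) = do
    cs ← tr x true A
    ds ← tr x true B
    return (cs ++ ds)
  tr x false (A ∨ B) = do
    cs ← tr x false A
    ds ← tr x false B
    return (cs ++ ds)
  tr x false (A ⇒ B) = do
    cs ← tr x true A
    ds ← tr x false B
    return (cs ++ ds)
  -- disjunctions: x ⇒ A ∨ B, x ⇒ ¬A ∨ B (from A ⇒ B), x ⇒ ¬A ∨ ¬B (from ¬(A ∧ B));
  -- rules (4) and (5)
  tr x true  (A ∨ B) = do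
    (ls , cs) ← disj true A
    (ms , ds) ← disj true B
    return (impD x (ls ++ ms) ++ cs ++ ds)
  tr x true  (A ⇒ B) = do
    (ls , cs) ← disj false A
    (ms , ds) ← disj true B
    return (impD x (ls ++ ms) ++ cs ++ ds)
  tr x false (A ∧ B) = do
    (ls , cs) ← disj false A
    (ms , ds) ← disj false B
    return (impD x (ls ++ ms) ++ cs ++ ds)
  tr x true (○ A) with litsOf true A
  ... | just D  = return (step ((true , x) ∷ []) (lits D) ∷ [])
  ... | nothing = do
    y ← new
    cs ← tr y true A
    return (step ((true , x) ∷ []) (lits ((true , y) ∷ [])) ∷ cs)
  tr x false (○ A) = do
    y ← new
    cs ← tr y false A
    return (step ((true , x) ∷ []) (lits ((true , y) ∷ [])) ∷ cs)
  tr x true (□ A) = do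
    (l , cs) ← lit true A
    ds ← boxLit x l
    return (ds ++ cs)
  tr x false (□ A) = do
    y ← new
    cs ← tr y false A
    return (sometime ((true , x) ∷ []) (true , y) ∷ cs)
  tr x true (◇ A) = do
    (l , cs) ← lit true A
    return (sometime ((true , x) ∷ []) l ∷ cs)
  tr x false (◇ A) = do
    y ← new
    ds ← boxLit x (true , y)
    cs ← tr y false A
    return (ds ++ cs)
  tr x true (A U B) = do
    (l , cs) ← lit true A
    (m , ds) ← lit true B
    es ← untilLit x l m
    return (es ++ cs ++ ds)
  tr x true (A W B) = do
    (l , cs) ← lit true A
    (m , ds) ← lit true B
    es ← unlessLit x l m
    return (es ++ cs ++ ds)
  tr x false (A U B) = do
    y ← new
    z ← new
    v ← new
    es ← unlessLit x (true , y) (true , v)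
    cs ← tr y false B
    let vs = impD v ((true , y) ∷ []) ++ impD v ((true , z) ∷ [])
    ds ← tr z false A
    return (es ++ cs ++ vs ++ ds)
  tr x false (A W B) = do
    y ← new
    z ← new
    v ← new
    es ← untilLit x (true , y) (true , v)
    cs ← tr y false B
    let vs = impD v ((true , y) ∷ []) ++ impD v ((true , z) ∷ [])
    ds ← tr z false A
    return (es ++ cs ++ vs ++ ds)

  lit : Bool → Form → Gen (Lit × List Clause)
  lit p A with litOf p A
  ... | just l  = return (l , [])
  ... | nothing = do
    y ← new
    cs ← tr y p A
    return ((true , y) , cs)

  disj : Bool → Form → Gen (List Lit × List Clause)
  disj p (var n) = return ((p , orig n) ∷ [] , [])
  disj p (¬ A) = disj (not p) A
  disj true (A ∨ B) = do
    (ls , cs) ← disj true A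
    (ms , ds) ← disj true B
    return (ls ++ ms , cs ++ ds)
  disj p A = do
    y ← new
    cs ← tr y p A
    return ((true , y) ∷ [] , cs)

-- τ₀[W] = □(start ⇒ y) ∧ τ₁[□(y ⇒ W)],  y fresh

τ₀ : Form → List Clause
τ₀ F = initial (lits ((true , fresh 0) ∷ [])) ∷ proj₁ (tr (fresh 0) true F 1)

-- Length of a formula (lenP p A = len(A) if p = true, len(¬A) if p = false)

lenP : Bool → Form → ℕ
lenP p (var n) = 1
lenP p ⊤f = 1
lenP p ⊥f = 1
lenP p (¬ A) = lenP (not p) A
lenP true (A ∨ B) =
  if is-just (litsOf true (A ∨ B)) then 1 else suc (lenP true A + lenP true B)
lenP false (A ∨ B) = suc (lenP false A + lenP false B)
lenP p (A ∧ B) = suc (lenP p A + lenP p B)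
lenP true  (A ⇒ B) = suc (lenP false A + lenP true B)
lenP false (A ⇒ B) = suc (lenP true A + lenP false B)
lenP true (○ A) = if is-just (litsOf true A) then 1 else suc (lenP true A)
lenP false (○ A) = suc (lenP false A)
lenP p (□ A) = suc (lenP p A)
lenP true (◇ A) = if is-just (litOf true A) then 1 else suc (lenP true A)
lenP false (◇ A) = suc (lenP false A)
lenP p (A U B) = suc (lenP p A + lenP p B)
lenP p (A W B) = suc (lenP p A + lenP p B)

len : Form → ℕ
len = lenP true

{-# OPTIONS --safe #-}
module Submission where

-- Each step of τ₁ removes one connective counted by len and emits at most
-- eleven clauses of its own (the worst case, x ⇒ ¬(A W B), emits seven for
-- x ⇒ y U v and four for v ⇒ y ∧ z); the subformulae it recurses on have
-- lengths summing to the rest.  A disjunction of literals has length 1 and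
-- spawns no recursion.  So τ₁[x ⇒ A] has at most 11 · len A clauses.

open import Defs
open import Data.Nat using (ℕ; suc; _+_; _*_; _≤_; _≤?_; z≤n; s≤s)
open import Data.Nat.Properties using (≤-refl; ≤-trans; +-mono-≤; *-suc; *-distribˡ-+; module ≤-Reasoning)
open import Data.Nat.Tactic.RingSolver using (solve-∀)
open import Data.List using (List; []; _++_; length)
open import Data.List.Properties using (length-++)
open import Data.Bool using (true; false; not)
open import Data.Maybe using (just; nothing)
open import Data.Product using (_×_; proj₁; proj₂)
open import Relation.Nullary.Decidable using (True; toWitness)
open import Relation.Binary.PropositionalEquality using (_≡_; refl; cong; cong₂)

open ≤-Reasoning

module _ {c : ℕ} where

  +-≤-*-suc : ∀ {k a x} → k ≤ c → a ≤ c * x → k + a ≤ c * suc x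
  +-≤-*-suc {k} {a} {x} k≤c a≤cx = begin
    k + a      ≤⟨ +-mono-≤ k≤c a≤cx ⟩
    c + c * x  ≡⟨ *-suc c x ⟨
    c * suc x  ∎

  +-≤-*-+ : ∀ {a b x y} → a ≤ c * x → b ≤ c * y → a + b ≤ c * (x + y)
  +-≤-*-+ {a} {b} {x} {y} a≤cx b≤cy = begin
    a + b          ≤⟨ +-mono-≤ a≤cx b≤cy ⟩
    c * x + c * y  ≡⟨ *-distribˡ-+ c x y ⟨
    c * (x + y)    ∎

  module _ {A : Set} {x y : ℕ} where

    length-++-≤ : ∀ {k} (xs : List A) {ys : List A} → k ≤ c →
                  length xs ≤ c * x → length ys ≤ c * y →
                  k + length (xs ++ ys) ≤ c * suc (x + y)
    length-++-≤ {k} xs {ys} k≤c xs≤ ys≤ = begin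
      k + length (xs ++ ys)        ≡⟨ cong (k +_) (length-++ xs) ⟩
      k + (length xs + length ys)  ≤⟨ +-≤-*-suc k≤c (+-≤-*-+ xs≤ ys≤) ⟩
      c * suc (x + y)              ∎

    length-++-++-≤ : ∀ k (xs ys : List A) {zs : List A} → k + length ys ≤ c →
                     length xs ≤ c * y → length zs ≤ c * x →
                     k + length (xs ++ ys ++ zs) ≤ c * suc (x + y)
    length-++-++-≤ k xs ys {zs} k+ys≤c xs≤ zs≤ = begin
      k + length (xs ++ ys ++ zs)                ≡⟨ cong (k +_) (length-++ xs) ⟩
      k + (length xs + length (ys ++ zs))        ≡⟨ cong (λ n → k + (length xs + n)) (length-++ ys) ⟩
      k + (length xs + (length ys + length zs))  ≡⟨ shuffle k (length xs) (length ys) (length zs) ⟩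
      (k + length ys) + (length zs + length xs)  ≤⟨ +-≤-*-suc k+ys≤c (+-≤-*-+ zs≤ xs≤) ⟩
      c * suc (x + y)                            ∎
      where
      shuffle : ∀ k a j b → k + (a + (j + b)) ≡ (k + j) + (b + a)
      shuffle = solve-∀

sideClauses : {L : Set} → Gen (L × List Clause) → ℕ → List Clause
sideClauses g n = proj₂ (proj₁ (g n))

litsOf⇒sideClauses≡[] : ∀ p A n {ls} → litsOf p A ≡ just ls → sideClauses (disj p A) n ≡ []
litsOf⇒sideClauses≡[] p (var _) n eq = refl
litsOf⇒sideClauses≡[] p (¬ A) n eq = litsOf⇒sideClauses≡[] (not p) A n eq
litsOf⇒sideClauses≡[] true (A ∨ B) n eq with litsOf true A in eqA | litsOf true B in eqB
... | just _ | just _ =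
  cong₂ _++_ (litsOf⇒sideClauses≡[] true A n eqA) (litsOf⇒sideClauses≡[] true B _ eqB)
litsOf⇒sideClauses≡[] true (A ∨ B) n () | just _ | nothing
litsOf⇒sideClauses≡[] true (A ∨ B) n () | nothing | _
litsOf⇒sideClauses≡[] false (A ∨ B) n ()
litsOf⇒sideClauses≡[] p ⊤f n ()
litsOf⇒sideClauses≡[] p ⊥f n ()
litsOf⇒sideClauses≡[] p (A ∧ B) n ()
litsOf⇒sideClauses≡[] p (A ⇒ B) n ()
litsOf⇒sideClauses≡[] p (○ A) n ()
litsOf⇒sideClauses≡[] p (◇ A) n ()
litsOf⇒sideClauses≡[] p (□ A) n ()
litsOf⇒sideClauses≡[] p (A U B) n ()
litsOf⇒sideClauses≡[] p (A W B) n ()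

-- Stated for every c ≥ 11 rather than for 11 itself: with a variable c the
-- bound c * lenP p A stays neutral, so unification recovers lenP p A.
module _ {c : ℕ} (11≤c : 11 ≤ c) where

  private
    ≤c : ∀ k {k≤11 : True (k ≤? 11)} → k ≤ c
    ≤c k {k≤11} = ≤-trans (toWitness k≤11) 11≤c

  mutual
    tr-≤ : ∀ x p A n → length (proj₁ (tr x p A n)) ≤ c * lenP p A
    tr-≤ x p (var _) n = +-≤-*-suc (≤c 2) z≤n
    tr-≤ x true ⊤f n = +-≤-*-suc (≤c 2) z≤n
    tr-≤ x false ⊤f n = +-≤-*-suc (≤c 2) z≤n
    tr-≤ x true ⊥f n = +-≤-*-suc (≤c 2) z≤n
    tr-≤ x false ⊥f n = +-≤-*-suc (≤c 2) z≤n
    tr-≤ x p (¬ A) n = tr-≤ x (not p) A n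
    tr-≤ x true (A ∧ B) n =
      length-++-≤ (proj₁ (tr x true A n)) (≤c 0) (tr-≤ x true A n) (tr-≤ x true B _)
    tr-≤ x false (A ∨ B) n =
      length-++-≤ (proj₁ (tr x false A n)) (≤c 0) (tr-≤ x false A n) (tr-≤ x false B _)
    tr-≤ x false (A ⇒ B) n =
      length-++-≤ (proj₁ (tr x true A n)) (≤c 0) (tr-≤ x true A n) (tr-≤ x false B _)
    tr-≤ x true (A ∨ B) n = disj-∨-≤ (≤c 2) A B n
    tr-≤ x true (A ⇒ B) n =
      length-++-≤ (sideClauses (disj false A) n) (≤c 2) (disj-≤ false A n) (disj-≤ true B _)
    tr-≤ x false (A ∧ B) n =
      length-++-≤ (sideClauses (disj false A) n) (≤c 2) (disj-≤ false A n) (disj-≤ false B _)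
    tr-≤ x true (○ A) n with litsOf true A
    ... | just _ = +-≤-*-suc (≤c 1) z≤n
    ... | nothing = +-≤-*-suc (≤c 1) (tr-≤ _ true A _)
    tr-≤ x false (○ A) n = +-≤-*-suc (≤c 1) (tr-≤ _ false A _)
    tr-≤ x true (□ A) n = +-≤-*-suc (≤c 6) (lit-≤ true A n)
    tr-≤ x false (□ A) n = +-≤-*-suc (≤c 1) (tr-≤ _ false A _)
    tr-≤ x true (◇ A) n with litOf true A
    ... | just _ = +-≤-*-suc (≤c 1) z≤n
    ... | nothing = +-≤-*-suc (≤c 1) (tr-≤ _ true A _)
    tr-≤ x false (◇ A) n = +-≤-*-suc (≤c 6) (tr-≤ _ false A _)
    tr-≤ x true (A U B) n =
      length-++-≤ (sideClauses (lit true A) n) (≤c 7) (lit-≤ true A n) (lit-≤ true B _)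
    tr-≤ x true (A W B) n =
      length-++-≤ (sideClauses (lit true A) n) (≤c 6) (lit-≤ true A n) (lit-≤ true B _)
    tr-≤ x false (A U B) n =
      length-++-++-≤ 6 (proj₁ (tr (fresh n) false B (4 + n))) (impD _ _ ++ impD _ _) (≤c 10)
        (tr-≤ _ false B _) (tr-≤ _ false A _)
    tr-≤ x false (A W B) n =
      length-++-++-≤ 7 (proj₁ (tr (fresh n) false B (4 + n))) (impD _ _ ++ impD _ _) (≤c 11)
        (tr-≤ _ false B _) (tr-≤ _ false A _)

    lit-≤ : ∀ p A n → length (sideClauses (lit p A) n) ≤ c * lenP p A
    lit-≤ p A n with litOf p A
    ... | just _ = z≤n
    ... | nothing = tr-≤ (fresh n) p A (suc n)

    disj-≤ : ∀ p A n → length (sideClauses (disj p A) n) ≤ c * lenP p A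
    disj-≤ p (var _) n = z≤n
    disj-≤ p (¬ A) n = disj-≤ (not p) A n
    disj-≤ true (A ∨ B) n = disj-∨-≤ (≤c 0) A B n
    disj-≤ false A@(_ ∨ _) n = tr-≤ (fresh n) false A (suc n)
    disj-≤ p A@⊤f n = tr-≤ (fresh n) p A (suc n)
    disj-≤ p A@⊥f n = tr-≤ (fresh n) p A (suc n)
    disj-≤ p A@(_ ∧ _) n = tr-≤ (fresh n) p A (suc n)
    disj-≤ p A@(_ ⇒ _) n = tr-≤ (fresh n) p A (suc n)
    disj-≤ p A@(○ _) n = tr-≤ (fresh n) p A (suc n)
    disj-≤ p A@(◇ _) n = tr-≤ (fresh n) p A (suc n)
    disj-≤ p A@(□ _) n = tr-≤ (fresh n) p A (suc n)
    disj-≤ p A@(_ U _) n = tr-≤ (fresh n) p A (suc n)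
    disj-≤ p A@(_ W _) n = tr-≤ (fresh n) p A (suc n)

    disj-∨-≤ : ∀ {k} → k ≤ c → ∀ A B n →
               k + length (sideClauses (disj true (A ∨ B)) n) ≤ c * lenP true (A ∨ B)
    disj-∨-≤ k≤c A B n with litsOf true A in eqA | litsOf true B in eqB
    ... | just _ | just _
      rewrite litsOf⇒sideClauses≡[] true A n eqA
            | litsOf⇒sideClauses≡[] true B (proj₂ (disj true A n)) eqB
      = +-≤-*-suc k≤c z≤n
    ... | just _ | nothing =
      length-++-≤ (sideClauses (disj true A) n) k≤c (disj-≤ true A n) (disj-≤ true B _)
    ... | nothing | _ =
      length-++-≤ (sideClauses (disj true A) n) k≤c (disj-≤ true A n) (disj-≤ true B _)

theorem6 : (φ : Form) → length (τ₀ φ) ≤ 1 + 11 * len φ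
theorem6 φ = s≤s (tr-≤ ≤-refl (fresh 0) true φ 1)
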